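{- Let $G$ be a finite simple graph on $n$ vertices with $e$ edges. (a) If $G$ is $K_5$-free, then $\tau_{B}(G) \le \frac{n^2}{4} - \frac{e}{3}$. (b) If $G$ is $K_6$-free, then $\tau_{B}(G) \le \frac{6n^2}{25} - \frac{e}{5}$.
   Context: All graphs are finite, simple and undirected. $\tau_{B}(G)$ denotes the minimum size of a set of edges whose deletion from $G$ leaves a bipartite graph. $K_r$-free means containing no complete subgraph on $r$ vertices. -}

module Defs where

open import Data.Nat using (ℕ; _<_)
open import Data.Bool using (Bool; true; false; T; not)
open import Data.Fin using (Fin; toℕ)
open import Data.Fin.Subset using (Subset; ∣_∣)
open import Data.Vec using (tabulate)
open import Data.Nat using (_<ᵇ_)
open import Data.Bool using (_∧_)
open import Data.List using (List; length; filter; allFin; concatMap; map)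
open import Data.Product using (Σ; _×_; _,_; ∃)
open import Relation.Binary.PropositionalEquality using (_≡_; _≢_)
open import Relation.Nullary using (¬_)
open import Relation.Nullary.Decidable using (does)
open import Data.Bool.Properties using (T?)

record Graph (n : ℕ) : Set where
  field
    adj   : Fin n → Fin n → Bool
    sym   : ∀ i j → adj i j ≡ adj j i
    irrefl : ∀ i → adj i i ≡ false
open Graph public

Adj : ∀ {n} → Graph n → Fin n → Fin n → Set
Adj G i j = T (adj G i j)

countEdges : ∀ {n} → (Fin n → Fin n → Bool) → ℕ
countEdges {n} r =
  length (filter (λ p → T? (r (Data.Product.proj₁ p) (Data.Product.proj₂ p)
                            ∧ (toℕ (Data.Product.proj₁ p) <ᵇ toℕ (Data.Product.proj₂ p))))
                 (concatMap (λ i → map (λ j → (i , j)) (allFin n)) (allFin n)))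

edges : ∀ {n} → Graph n → ℕ
edges G = countEdges (adj G)

HasClique : ∀ {n} → Graph n → ℕ → Set
HasClique {n} G r =
  Σ (Fin r → Fin n) λ f → ∀ a b → a ≢ b → Adj G (f a) (f b)

KFree : ∀ {n} → Graph n → ℕ → Set
KFree G r = ¬ HasClique G r

IsBipartite : ∀ {n} → (Fin n → Fin n → Bool) → Set
IsBipartite {n} r = Σ (Fin n → Bool) λ c → ∀ i j → T (r i j) → c i ≢ c j

minus : ∀ {n} → (Fin n → Fin n → Bool) → (Fin n → Fin n → Bool) → (Fin n → Fin n → Bool)
minus r F i j = r i j ∧ not (F i j)

-- τ_B(G) ≤ t : there is a set F of edges of G, |F| ≤ t, with G − F bipartite.
-- (τ_B(G) is the minimum of |F| over such F, so this is exactly τ_B(G) ≤ t.)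
TauBAtMost : ∀ {n} → Graph n → ℕ → Set
TauBAtMost {n} G t =
  Σ (Fin n → Fin n → Bool) λ F →
      (∀ i j → F i j ≡ F j i)
    × (∀ i j → T (F i j) → Adj G i j)
    × (countEdges F Data.Nat.≤ t)
    × IsBipartite (minus (adj G) F)

module Submission where

-- All counting is done over ordered pairs of vertices, so every edge is
-- counted twice and no division is needed.  A K_{k+2}-free graph has
--     a partition p into k+1 parts with  2e + 2e_in ≤ 2e(K_p), where e_in
--     counts edges inside parts and K_p is the complete multipartite graph
--     with parts p: put the non-neighbours of a vertex of maximum degree
--     into one part and recurse into its neighbourhood, which is
--     K_{k+1}-free.  By Cauchy–Schwarz on the part sizes, (k+1)·2e(K_p) ≤ k·n².
--  2. Averaging.  Given K+1 two-colourings of the k+1 parts under which two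
--     parts get the same colour exactly α + β·[a = b] times, the best of
--     them has at most (α·2e + β·2e_in)/(K+1) monochromatic ordered edges;
--     deleting these edges leaves a bipartite graph.
--  3. Combining gives a general linear bound on τ_B (tauB-bound); the
--     corollary is its instance for the three 2+2 splittings of 4 parts
--     (α, β) = (1, 2) and the ten 2+3 splittings of 5 parts (α, β) = (4, 6).

open import Defs renaming (sym to adj-sym)
open import Data.Nat using (ℕ; zero; suc; _+_; _*_; _≤_; _<_; z≤n; s≤s; s≤s⁻¹; _<ᵇ_)
open import Data.Nat.Properties hiding (_≟_)
import Data.Nat.Properties as ℕₚ
open import Data.Bool using (Bool; true; false; T; not; _∧_; _∨_; if_then_else_)
open import Data.Bool.Properties using (∧-identityʳ; ∧-zeroʳ; T-≡; T-∧) renaming (_≟_ to _≟ᵇ_)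
open import Data.Fin using (Fin; zero; suc; toℕ; #_)
open import Data.Fin.Properties using (toℕ-injective; _≟_; any?; all?)
open import Data.List using (List; length; filter; allFin; concatMap; map; tabulate)
open import Data.List.Properties using (length-++; filter-++; map-tabulate)
open import Data.List.Membership.Propositional.Properties using (∈-allFin)
open import Data.List.Extrema.Nat using (argmax; argmin; f[xs]≤f[argmax]; f[argmin]≤f[xs])
import Data.List.Relation.Unary.All as All
open import Data.Vec using (Vec; []; _∷_; lookup)
open import Data.Product using (Σ; _×_; _,_; proj₁; proj₂)
open import Data.Sum using (inj₁; inj₂)
open import Data.Empty using (⊥; ⊥-elim)
open import Data.Unit using (tt)
open import Function using (_∘_; id; Equivalence)
open import Relation.Binary.PropositionalEquality
open import Relation.Binary.Definitions using (tri<; tri≈; tri>)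
open import Relation.Nullary using (¬_; does; yes; no)
open import Relation.Nullary.Decidable using (T?; toWitness)
open import Algebra.Properties.Semiring.Sum +-*-semiring
  using (sum; sum-syntax; ∑-distrib-+; ∑-comm; sum-cong-≗; *-distribˡ-sum; *-distribʳ-sum)
open import Data.Nat.Solver using (module +-*-Solver)
open +-*-Solver using (solve; _:=_; _:+_; _:*_; con)

open Equivalence using (to; from)

ind : Bool → ℕ
ind true = 1
ind false = 0

when : Bool → ℕ → ℕ
when true x = x
when false x = 0

sum-const : ∀ {n} c → ∑[ i < n ] c ≡ n * c
sum-const {zero} c = refl
sum-const {suc n} c = cong (c +_) (sum-const {n} c)

sum-zero : ∀ {n} → ∑[ i < n ] 0 ≡ 0
sum-zero {n} = trans (sum-const {n} 0) (*-zeroʳ n)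

sum-mono : ∀ {n} {f g : Fin n → ℕ} → (∀ i → f i ≤ g i) → sum f ≤ sum g
sum-mono {zero} h = z≤n
sum-mono {suc n} h = +-mono-≤ (h zero) (sum-mono (h ∘ suc))

sum-when : ∀ {n} b (h : Fin n → ℕ) → ∑[ j < n ] when b (h j) ≡ when b (sum h)
sum-when true h = refl
sum-when {n} false h = sum-zero {n}

sum-select : ∀ {r} (a : Fin r) (h : Fin r → ℕ) → ∑[ k < r ] (ind (does (a ≟ k)) * h k) ≡ h a
sum-select {suc r} zero h =
  trans (cong (h zero + 0 +_) (sum-zero {r})) (trans (+-identityʳ _) (+-identityʳ _))
sum-select {suc r} (suc a) h = sum-select a (h ∘ suc)

∑∑ : ∀ {n} → (Fin n → Fin n → ℕ) → ℕ
∑∑ {n} f = ∑[ i < n ] ∑[ j < n ] f i j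

∑∑-cong : ∀ {n} {f g : Fin n → Fin n → ℕ} → (∀ i j → f i j ≡ g i j) → ∑∑ f ≡ ∑∑ g
∑∑-cong h = sum-cong-≗ (λ i → sum-cong-≗ (h i))

∑∑-mono : ∀ {n} {f g : Fin n → Fin n → ℕ} → (∀ i j → f i j ≤ g i j) → ∑∑ f ≤ ∑∑ g
∑∑-mono h = sum-mono (λ i → sum-mono (h i))

∑∑-+ : ∀ {n} (f g : Fin n → Fin n → ℕ) → ∑∑ (λ i j → f i j + g i j) ≡ ∑∑ f + ∑∑ g
∑∑-+ f g = trans (sum-cong-≗ (λ i → ∑-distrib-+ (f i) (g i))) (∑-distrib-+ (λ i → sum (f i)) (λ i → sum (g i)))

∑∑-*ˡ : ∀ {n} c (f : Fin n → Fin n → ℕ) → ∑∑ (λ i j → c * f i j) ≡ c * ∑∑ f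
∑∑-*ˡ c f = sym (trans (*-distribˡ-sum c (λ i → sum (f i))) (sum-cong-≗ (λ i → *-distribˡ-sum c (f i))))

private
  length-filter-tabulate : ∀ {A : Set} {n} (P : A → Bool) (f : Fin n → A) →
    length (filter (T? ∘ P) (tabulate f)) ≡ ∑[ i < n ] ind (P (f i))
  length-filter-tabulate {n = zero} P f = refl
  length-filter-tabulate {n = suc n} P f with P (f zero)
  ... | true = cong suc (length-filter-tabulate P (f ∘ suc))
  ... | false = length-filter-tabulate P (f ∘ suc)

  length-filter-concatMap : ∀ {A B : Set} {n} (P : A → Bool) (h : B → List A) (f : Fin n → B) →
    length (filter (T? ∘ P) (concatMap h (tabulate f)))
      ≡ ∑[ i < n ] length (filter (T? ∘ P) (h (f i)))
  length-filter-concatMap {n = zero} P h f = refl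
  length-filter-concatMap {n = suc n} P h f =
    trans (cong length (filter-++ (T? ∘ P) (h (f zero)) _))
          (trans (length-++ (filter (T? ∘ P) (h (f zero))))
                 (cong (_ +_) (length-filter-concatMap P h (f ∘ suc))))

countEdges-∑∑ : ∀ {n} (r : Fin n → Fin n → Bool) →
  countEdges r ≡ ∑∑ (λ i j → ind (r i j ∧ (toℕ i <ᵇ toℕ j)))
countEdges-∑∑ {n} r =
  trans (length-filter-concatMap P (λ i → map (i ,_) (allFin n)) id)
        (sum-cong-≗ λ i → trans (cong (length ∘ filter (T? ∘ P)) (map-tabulate id (i ,_)))
                                (length-filter-tabulate P (i ,_)))
  where
  P : Fin n × Fin n → Bool
  P (i , j) = r i j ∧ (toℕ i <ᵇ toℕ j)

private
  ≮ᵇ-antisym : ∀ a b → (a <ᵇ b) ≡ false → (b <ᵇ a) ≡ false → a ≡ b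
  ≮ᵇ-antisym a b a≮b b≮a with <-cmp a b
  ... | tri< lt _ _ = ⊥-elim (subst T a≮b (<⇒<ᵇ lt))
  ... | tri≈ _ eq _ = eq
  ... | tri> _ _ gt = ⊥-elim (subst T b≮a (<⇒<ᵇ gt))

  ordered-pair-split : ∀ {n} (r : Fin n → Fin n → Bool) → (∀ i j → r i j ≡ r j i) →
    (∀ i → r i i ≡ false) → ∀ i j →
    ind (r i j ∧ (toℕ i <ᵇ toℕ j)) + ind (r j i ∧ (toℕ j <ᵇ toℕ i)) ≡ ind (r i j)
  ordered-pair-split r r-sym r-irr i j with toℕ i <ᵇ toℕ j in i<j | toℕ j <ᵇ toℕ i in j<i
  ... | true | true =
    ⊥-elim (<-asym (<ᵇ⇒< (toℕ i) (toℕ j) (from T-≡ i<j)) (<ᵇ⇒< (toℕ j) (toℕ i) (from T-≡ j<i)))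
  ... | true | false rewrite ∧-identityʳ (r i j) | ∧-zeroʳ (r j i) = +-identityʳ _
  ... | false | true rewrite ∧-identityʳ (r j i) | ∧-zeroʳ (r i j) = cong ind (r-sym j i)
  ... | false | false rewrite ∧-zeroʳ (r j i) | ∧-zeroʳ (r i j)
        | toℕ-injective (≮ᵇ-antisym (toℕ i) (toℕ j) i<j j<i) | r-irr j = refl

countEdges-double : ∀ {n} (r : Fin n → Fin n → Bool) → (∀ i j → r i j ≡ r j i) →
  (∀ i → r i i ≡ false) → 2 * countEdges r ≡ ∑∑ (λ i j → ind (r i j))
countEdges-double {n} r r-sym r-irr = begin
  2 * countEdges r                          ≡⟨ cong (countEdges r +_) (+-identityʳ _) ⟩
  countEdges r + countEdges r               ≡⟨ cong₂ _+_ (countEdges-∑∑ r)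
                                                 (trans (countEdges-∑∑ r) (∑-comm below)) ⟩
  ∑∑ below + ∑∑ (λ i j → below j i)         ≡⟨ sym (∑∑-+ below (λ i j → below j i)) ⟩
  ∑∑ (λ i j → below i j + below j i)        ≡⟨ ∑∑-cong (ordered-pair-split r r-sym r-irr) ⟩
  ∑∑ (λ i j → ind (r i j))                  ∎
  where
  open ≡-Reasoning
  below : Fin n → Fin n → ℕ
  below i j = ind (r i j ∧ (toℕ i <ᵇ toℕ j))

-- The partition lemma

KFreeOn : ∀ {n} → Graph n → (Fin n → Bool) → ℕ → Set
KFreeOn {n} G U m =
  (f : Fin m → Fin n) → (∀ a → T (U (f a))) → (∀ a b → a ≢ b → Adj G (f a) (f b)) → ⊥

-- Ordered edges of G[U], weighted 2 when both ends lie in the same part of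
-- p; that is, 2e(G[U]) + 2·#(edges of G[U] inside a part of p).
edgeWeight : ∀ {n m} → Graph n → (Fin n → Bool) → (Fin n → Fin m) → ℕ
edgeWeight G U p =
  ∑∑ λ i j → when (U i) (when (U j) (when (adj G i j) (1 + ind (does (p i ≟ p j)))))

-- Ordered pairs of U in different parts of p; that is, twice the number of
-- edges of the complete multipartite graph on U with the parts of p.
crossPairs : ∀ {n m} → (Fin n → Bool) → (Fin n → Fin m) → ℕ
crossPairs U p = ∑∑ λ i j → when (U i) (when (U j) (ind (not (does (p i ≟ p j)))))

deg : ∀ {n} → Graph n → (Fin n → Bool) → Fin n → ℕ
deg {n} G U v = ∑[ j < n ] when (U j) (ind (adj G v j))

edgeless-partition : ∀ {n m} (G : Graph n) (U : Fin n → Bool) (p : Fin n → Fin m) →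
  (∀ i j → T (U i) → T (U j) → ¬ Adj G i j) → edgeWeight G U p ≤ crossPairs U p
edgeless-partition G U p no-edge = ∑∑-mono pointwise
  where
  pointwise : ∀ i j → when (U i) (when (U j) (when (adj G i j) (1 + ind (does (p i ≟ p j)))))
                    ≤ when (U i) (when (U j) (ind (not (does (p i ≟ p j)))))
  pointwise i j with U i in ui | U j in uj | adj G i j in aij
  ... | true  | true  | true  = ⊥-elim (no-edge i j (from T-≡ ui) (from T-≡ uj) (from T-≡ aij))
  ... | true  | true  | false = z≤n
  ... | true  | false | _     = z≤n
  ... | false | _     | _     = z≤n

-- The part of a vertex after adding the non-neighbours of x as a new part 0:
-- c says whether the vertex is a neighbour, q is its old part.
extendPart : ∀ {m} → Bool → Fin m → Fin (suc m)
extendPart c q = if c then suc q else zero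

-- Pointwise block decomposition of the summands of edgeWeight and crossPairs
-- for the extended partition, by the membership of i and j in U and in N(x)
-- (b and c below): N–A and A–N pairs, A–A pairs, and N–N pairs.
private
  edgeWeight-blocks : ∀ {m} (bi ci bj cj a : Bool) (qi qj : Fin m) →
    when bi (when bj (when a (1 + ind (does (extendPart ci qi ≟ extendPart cj qj))))) ≡
      (when (bi ∧ ci) (when (bj ∧ not cj) (ind a)) + when (bi ∧ not ci) (when (bj ∧ cj) (ind a))
        + 2 * when (bi ∧ not ci) (when (bj ∧ not cj) (ind a)))
      + when (bi ∧ ci) (when (bj ∧ cj) (when a (1 + ind (does (qi ≟ qj)))))
  edgeWeight-blocks false _ _ _ _ _ _ = refl
  edgeWeight-blocks true true false _ _ _ _ = refl
  edgeWeight-blocks true false false _ _ _ _ = refl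
  edgeWeight-blocks true true true true _ _ _ = refl
  edgeWeight-blocks true true true false true _ _ = refl
  edgeWeight-blocks true true true false false _ _ = refl
  edgeWeight-blocks true false true true true _ _ = refl
  edgeWeight-blocks true false true true false _ _ = refl
  edgeWeight-blocks true false true false true _ _ = refl
  edgeWeight-blocks true false true false false _ _ = refl

  crossPairs-blocks : ∀ {m} (bi ci bj cj : Bool) (qi qj : Fin m) →
    when bi (when bj (ind (not (does (extendPart ci qi ≟ extendPart cj qj))))) ≡
      (when (bi ∧ ci) (when (bj ∧ not cj) 1) + when (bi ∧ not ci) (when (bj ∧ cj) 1))
      + when (bi ∧ ci) (when (bj ∧ cj) (ind (not (does (qi ≟ qj)))))
  crossPairs-blocks false _ _ _ _ _ = refl
  crossPairs-blocks true true false _ _ _ = refl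
  crossPairs-blocks true false false _ _ _ = refl
  crossPairs-blocks true true true true _ _ = refl
  crossPairs-blocks true true true false _ _ = refl
  crossPairs-blocks true false true true _ _ = refl
  crossPairs-blocks true false true false _ _ = refl

private
  when-split : ∀ b c y → when b y ≡ when (b ∧ c) y + when (b ∧ not c) y
  when-split true true y = sym (+-identityʳ y)
  when-split true false y = refl
  when-split false c y = refl

  when-+ : ∀ b x y → when b (x + y) ≡ when b x + when b y
  when-+ true x y = refl
  when-+ false x y = refl

  when-comm : ∀ b c y → when b (when c y) ≡ when c (when b y)
  when-comm true c y = refl
  when-comm false true y = refl
  when-comm false false y = refl

  when-∧ : ∀ b c → when (b ∧ c) 1 ≡ when b (ind c)
  when-∧ true true = refl
  when-∧ true false = refl
  when-∧ false c = refl

-- Let x be a vertex of maximum degree in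
-- G[U], N = U ∩ N(x) and A = U ∖ N(x).  A partition p' of N satisfying the
-- partition inequality extends, by the new part A, to one of U: the extra
-- weight is 2·Σ_{i∈A} deg_U(i) on the left and 2·|A|·|N| = 2·|A|·deg_U(x)
-- on the right.
module Extend {n} (G : Graph n) (U : Fin n → Bool) (x : Fin n)
              (x-max : ∀ i → T (U i) → deg G U i ≤ deg G U x) where

  N A : Fin n → Bool
  N v = U v ∧ adj G x v
  A v = U v ∧ not (adj G x v)

  NA AN AA NA' AN' : Fin n → Fin n → ℕ
  NA i j = when (N i) (when (A j) (ind (adj G i j)))
  AN i j = when (A i) (when (N j) (ind (adj G i j)))
  AA i j = when (A i) (when (A j) (ind (adj G i j)))
  NA' i j = when (N i) (when (A j) 1)
  AN' i j = when (A i) (when (N j) 1)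

  NA≡AN : ∑∑ NA ≡ ∑∑ AN
  NA≡AN = trans (∑-comm NA) (∑∑-cong λ i j →
    trans (when-comm (N j) (A i) _) (cong (λ b → when (A i) (when (N j) (ind b))) (adj-sym G j i)))

  NA'≡AN' : ∑∑ NA' ≡ ∑∑ AN'
  NA'≡AN' = trans (∑-comm NA') (∑∑-cong λ i j → when-comm (N j) (A i) 1)

  AU-edges : ∑∑ (λ i j → AN i j + AA i j) ≡ ∑[ i < n ] when (A i) (deg G U i)
  AU-edges = sum-cong-≗ λ i →
    trans (sum-cong-≗ λ j → trans (sym (when-+ (A i) _ _))
                                  (cong (when (A i)) (sym (when-split (U j) (adj G x j) _))))
          (sum-when (A i) (λ j → when (U j) (ind (adj G i j))))

  AN-pairs : ∑∑ AN' ≡ ∑[ i < n ] when (A i) (deg G U x)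
  AN-pairs = sum-cong-≗ λ i →
    trans (sum-when (A i) (λ j → when (N j) 1))
          (cong (when (A i)) (sum-cong-≗ λ j → when-∧ (U j) (adj G x j)))

  new-edgeWeight : ∑∑ (λ i j → NA i j + AN i j + 2 * AA i j) ≡ 2 * ∑[ i < n ] when (A i) (deg G U i)
  new-edgeWeight = begin
    ∑∑ (λ i j → NA i j + AN i j + 2 * AA i j)  ≡⟨ ∑∑-+ (λ i j → NA i j + AN i j) (λ i j → 2 * AA i j) ⟩
    ∑∑ (λ i j → NA i j + AN i j) + ∑∑ (λ i j → 2 * AA i j) ≡⟨ cong₂ _+_ (∑∑-+ NA AN) (∑∑-*ˡ 2 AA) ⟩
    ∑∑ NA + ∑∑ AN + 2 * ∑∑ AA                   ≡⟨ cong (λ s → s + ∑∑ AN + 2 * ∑∑ AA) NA≡AN ⟩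
    ∑∑ AN + ∑∑ AN + 2 * ∑∑ AA                   ≡⟨ solve 2 (λ s t → s :+ s :+ con 2 :* t := con 2 :* (s :+ t))
                                                           refl (∑∑ AN) (∑∑ AA) ⟩
    2 * (∑∑ AN + ∑∑ AA)                         ≡⟨ cong (2 *_) (sym (∑∑-+ AN AA)) ⟩
    2 * ∑∑ (λ i j → AN i j + AA i j)            ≡⟨ cong (2 *_) AU-edges ⟩
    2 * ∑[ i < n ] when (A i) (deg G U i)       ∎
    where open ≡-Reasoning

  new-crossPairs : ∑∑ (λ i j → NA' i j + AN' i j) ≡ 2 * ∑[ i < n ] when (A i) (deg G U x)
  new-crossPairs = begin
    ∑∑ (λ i j → NA' i j + AN' i j)  ≡⟨ ∑∑-+ NA' AN' ⟩
    ∑∑ NA' + ∑∑ AN'                 ≡⟨ cong (_+ ∑∑ AN') NA'≡AN' ⟩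
    ∑∑ AN' + ∑∑ AN'                 ≡⟨ cong (∑∑ AN' +_) (sym (+-identityʳ _)) ⟩
    2 * ∑∑ AN'                      ≡⟨ cong (2 *_) AN-pairs ⟩
    2 * ∑[ i < n ] when (A i) (deg G U x) ∎
    where open ≡-Reasoning

  A-degrees : ∑[ i < n ] when (A i) (deg G U i) ≤ ∑[ i < n ] when (A i) (deg G U x)
  A-degrees = sum-mono pointwise
    where
    pointwise : ∀ i → when (A i) (deg G U i) ≤ when (A i) (deg G U x)
    pointwise i with U i in ui | adj G x i
    ... | true  | true  = ≤-refl
    ... | true  | false = x-max i (from T-≡ ui)
    ... | false | _     = ≤-refl

  extended : ∀ {m} → (Fin n → Fin m) → Fin n → Fin (suc m)
  extended p' v = extendPart (adj G x v) (p' v)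

  edgeWeight-extended : ∀ {m} (p' : Fin n → Fin m) →
    edgeWeight G U (extended p') ≡ ∑∑ (λ i j → NA i j + AN i j + 2 * AA i j) + edgeWeight G N p'
  edgeWeight-extended p' =
    trans (∑∑-cong λ i j → edgeWeight-blocks (U i) (adj G x i) (U j) (adj G x j) (adj G i j) (p' i) (p' j))
          (∑∑-+ (λ i j → NA i j + AN i j + 2 * AA i j) _)

  crossPairs-extended : ∀ {m} (p' : Fin n → Fin m) →
    crossPairs U (extended p') ≡ ∑∑ (λ i j → NA' i j + AN' i j) + crossPairs N p'
  crossPairs-extended p' =
    trans (∑∑-cong λ i j → crossPairs-blocks (U i) (adj G x i) (U j) (adj G x j) (p' i) (p' j))
          (∑∑-+ (λ i j → NA' i j + AN' i j) _)

  extend : ∀ {m} (p' : Fin n → Fin m) → edgeWeight G N p' ≤ crossPairs N p' →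
    edgeWeight G U (extended p') ≤ crossPairs U (extended p')
  extend p' ih = begin
    edgeWeight G U (extended p')                             ≡⟨ edgeWeight-extended p' ⟩
    ∑∑ (λ i j → NA i j + AN i j + 2 * AA i j) + edgeWeight G N p'
                                                             ≤⟨ +-mono-≤ (≤-reflexive new-edgeWeight) ih ⟩
    2 * ∑[ i < n ] when (A i) (deg G U i) + crossPairs N p'  ≤⟨ +-monoˡ-≤ _ (*-monoʳ-≤ 2 A-degrees) ⟩
    2 * ∑[ i < n ] when (A i) (deg G U x) + crossPairs N p'  ≡⟨ cong (_+ crossPairs N p') (sym new-crossPairs) ⟩
    ∑∑ (λ i j → NA' i j + AN' i j) + crossPairs N p'         ≡⟨ sym (crossPairs-extended p') ⟩
    crossPairs U (extended p')                               ∎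
    where open ≤-Reasoning

maximiser : ∀ {n} (f : Fin n → ℕ) → Fin n → Σ (Fin n) λ x → ∀ v → f v ≤ f x
maximiser {n} f d =
  argmax f d (allFin n) , λ v → All.lookup (f[xs]≤f[argmax] {f = f} d (allFin n)) (∈-allFin v)

private
  when-T : ∀ {b} y → T b → when b y ≡ y
  when-T {true} y _ = refl

  when-pos⁻¹ : ∀ {b} y → 0 < when b y → T b
  when-pos⁻¹ {true} y _ = tt

KFreeOn-2 : ∀ {n} (G : Graph n) (U : Fin n → Bool) → KFreeOn G U 2 →
  ∀ i j → T (U i) → T (U j) → ¬ Adj G i j
KFreeOn-2 {n} G U kf i j ui uj i~j = kf f f∈U f-clique
  where
  f : Fin 2 → Fin n
  f zero = i
  f (suc _) = j
  f∈U : ∀ a → T (U (f a))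
  f∈U zero = ui
  f∈U (suc _) = uj
  f-clique : ∀ a b → a ≢ b → Adj G (f a) (f b)
  f-clique zero zero a≢b = ⊥-elim (a≢b refl)
  f-clique zero (suc zero) _ = i~j
  f-clique (suc zero) zero _ = subst T (adj-sym G i j) i~j
  f-clique (suc zero) (suc zero) a≢b = ⊥-elim (a≢b refl)

-- If G[U] is K_{m+1}-free and x ∈ U, the neighbourhood of x in U is K_m-free:
-- a clique there extends by x.
KFreeOn-neighbourhood : ∀ {n} (G : Graph n) (U : Fin n → Bool) {m} x → T (U x) →
  KFreeOn G U (suc m) → KFreeOn G (λ v → U v ∧ adj G x v) m
KFreeOn-neighbourhood {n} G U {m} x ux kf f f∈N f-clique = kf f' f'∈U f'-clique
  where
  f' : Fin (suc m) → Fin n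
  f' zero = x
  f' (suc a) = f a
  x~f : ∀ a → Adj G x (f a)
  x~f a = proj₂ (to T-∧ (f∈N a))
  f'∈U : ∀ a → T (U (f' a))
  f'∈U zero = ux
  f'∈U (suc a) = proj₁ (to T-∧ (f∈N a))
  f'-clique : ∀ a b → a ≢ b → Adj G (f' a) (f' b)
  f'-clique zero zero a≢b = ⊥-elim (a≢b refl)
  f'-clique zero (suc b) _ = x~f b
  f'-clique (suc a) zero _ = subst T (adj-sym G x (f a)) (x~f a)
  f'-clique (suc a) (suc b) a≢b = f-clique a b (a≢b ∘ cong suc)

partition-lemma : ∀ k {n} (G : Graph n) (U : Fin n → Bool) → KFreeOn G U (2 + k) →
  Σ (Fin n → Fin (suc k)) λ p → edgeWeight G U p ≤ crossPairs U p
partition-lemma zero G U kf = (λ _ → zero) , edgeless-partition G U (λ _ → zero {0}) (KFreeOn-2 G U kf)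
partition-lemma (suc k) {n} G U kf with any? (λ v → T? (U v))
... | no U-empty =
  (λ _ → zero) , edgeless-partition G U (λ _ → zero {suc k}) (λ i _ ui _ _ → U-empty (i , ui))
... | yes (x₀ , ux₀) =
  Extend.extended G U x x-max (proj₁ rec) , Extend.extend G U x x-max (proj₁ rec) (proj₂ rec)
  where
  score : Fin n → ℕ
  score v = when (U v) (suc (deg G U v))
  x : Fin n
  x = proj₁ (maximiser score x₀)
  x-maximal : ∀ v → score v ≤ score x
  x-maximal = proj₂ (maximiser score x₀)

  ux : T (U x)
  ux = when-pos⁻¹ _ (<-≤-trans (subst (0 <_) (sym (when-T _ ux₀)) (s≤s z≤n)) (x-maximal x₀))

  x-max : ∀ i → T (U i) → deg G U i ≤ deg G U x
  x-max i ui = s≤s⁻¹ (subst₂ _≤_ (when-T _ ui) (when-T _ ux) (x-maximal i))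

  rec : Σ (Fin n → Fin (suc k)) λ p → edgeWeight G (λ v → U v ∧ adj G x v) p ≤ crossPairs (λ v → U v ∧ adj G x v) p
  rec = partition-lemma k G (λ v → U v ∧ adj G x v) (KFreeOn-neighbourhood G U x ux kf)

-- Cauchy–Schwarz and the size of a complete multipartite graph

private
  amgm-ordered : ∀ a d → 2 * a * (a + d) ≤ a * a + (a + d) * (a + d)
  amgm-ordered a d =
    subst (2 * a * (a + d) ≤_)
          (solve 2 (λ a d → con 2 :* a :* (a :+ d) :+ d :* d := a :* a :+ (a :+ d) :* (a :+ d)) refl a d)
          (m≤m+n _ (d * d))

-- 2ab ≤ a² + b²: writing the larger as a + d, the difference is d².
amgm : ∀ a b → 2 * a * b ≤ a * a + b * b
amgm a b with ≤-total a b
... | inj₁ a≤b with m≤n⇒∃[o]m+o≡n a≤b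
...   | d , refl = amgm-ordered a d
amgm a b | inj₂ b≤a with m≤n⇒∃[o]m+o≡n b≤a
...   | d , refl =
  subst₂ _≤_ (trans (*-assoc 2 b (b + d)) (trans (cong (2 *_) (*-comm b (b + d))) (sym (*-assoc 2 (b + d) b))))
             (+-comm (b * b) _) (amgm-ordered b d)

-- Cauchy–Schwarz: (Σ f)² ≤ k · Σ f², by induction on k using 2ab ≤ a² + b².
sum-square≤ : ∀ {k} (f : Fin k → ℕ) → sum f * sum f ≤ k * ∑[ i < k ] (f i * f i)
sum-square≤ {zero} f = z≤n
sum-square≤ {suc k} f = begin
  (a + s) * (a + s)                           ≡⟨ solve 2 (λ a s → (a :+ s) :* (a :+ s)
                                                     := a :* a :+ con 2 :* a :* s :+ s :* s) refl a s ⟩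
  a * a + 2 * a * s + s * s                   ≡⟨ cong (λ z → a * a + z + s * s) (*-distribˡ-sum (2 * a) g) ⟩
  a * a + ∑[ i < k ] (2 * a * g i) + s * s    ≤⟨ +-mono-≤ (+-monoʳ-≤ (a * a) (sum-mono λ i → amgm a (g i)))
                                                          (sum-square≤ g) ⟩
  a * a + ∑[ i < k ] (a * a + g i * g i) + k * Q
                                              ≡⟨ cong (λ z → a * a + z + k * Q)
                                                   (trans (∑-distrib-+ (λ _ → a * a) (λ i → g i * g i))
                                                          (cong (_+ Q) (sum-const {k} (a * a)))) ⟩
  a * a + (k * (a * a) + Q) + k * Q           ≡⟨ solve 3 (λ a k Q → a :* a :+ (k :* (a :* a) :+ Q) :+ k :* Q
                                                     := (con 1 :+ k) :* (a :* a :+ Q)) refl a k Q ⟩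
  suc k * (a * a + Q)                         ∎
  where
  open ≤-Reasoning
  a s Q : ℕ
  g : Fin k → ℕ
  a = f zero
  g = f ∘ suc
  s = sum g
  Q = ∑[ i < k ] (g i * g i)

partSize : ∀ {n r} → (Fin n → Fin r) → Fin r → ℕ
partSize {n} p c = ∑[ i < n ] ind (does (p i ≟ c))

n≡∑partSize : ∀ {n r} (p : Fin n → Fin r) → n ≡ ∑[ c < r ] partSize p c
n≡∑partSize {n} {r} p = begin
  n                                              ≡⟨ sym (*-identityʳ n) ⟩
  n * 1                                          ≡⟨ sym (sum-const {n} 1) ⟩
  ∑[ i < n ] 1                                   ≡⟨ sum-cong-≗ (λ i → sym (one-part i)) ⟩
  ∑[ i < n ] ∑[ c < r ] ind (does (p i ≟ c))     ≡⟨ ∑-comm (λ i c → ind (does (p i ≟ c))) ⟩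
  ∑[ c < r ] partSize p c                        ∎
  where
  open ≡-Reasoning
  one-part : ∀ i → ∑[ c < r ] ind (does (p i ≟ c)) ≡ 1
  one-part i = trans (sum-cong-≗ {n = r} λ c → sym (*-identityʳ _)) (sum-select (p i) (λ _ → 1))

samePairs≡∑partSize² : ∀ {n r} (p : Fin n → Fin r) →
  ∑∑ (λ i j → ind (does (p i ≟ p j))) ≡ ∑[ c < r ] (partSize p c * partSize p c)
samePairs≡∑partSize² {n} {r} p = begin
  ∑∑ (λ i j → ind (does (p i ≟ p j)))
    ≡⟨ ∑∑-cong (λ i j → sym (sum-select (p j) (λ c → χ c i))) ⟩
  ∑[ i < n ] ∑[ j < n ] ∑[ c < r ] (χ c j * χ c i)
    ≡⟨ sum-cong-≗ (λ i → ∑-comm (λ j c → χ c j * χ c i)) ⟩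
  ∑[ i < n ] ∑[ c < r ] ∑[ j < n ] (χ c j * χ c i)
    ≡⟨ ∑-comm (λ i c → ∑[ j < n ] (χ c j * χ c i)) ⟩
  ∑[ c < r ] ∑[ i < n ] ∑[ j < n ] (χ c j * χ c i)
    ≡⟨ sum-cong-≗ (λ c → trans (sum-cong-≗ λ i → sym (*-distribʳ-sum (χ c i) (λ j → χ c j)))
                               (sym (*-distribˡ-sum (partSize p c) (χ c)))) ⟩
  ∑[ c < r ] (partSize p c * partSize p c) ∎
  where
  open ≡-Reasoning
  χ : Fin r → Fin n → ℕ
  χ c i = ind (does (p i ≟ c))

crossPairs+samePairs : ∀ {n r} (p : Fin n → Fin r) →
  crossPairs (λ _ → true) p + ∑∑ (λ i j → ind (does (p i ≟ p j))) ≡ n * n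
crossPairs+samePairs {n} p = begin
  crossPairs (λ _ → true) p + ∑∑ (λ i j → ind (does (p i ≟ p j)))
    ≡⟨ sym (∑∑-+ (λ i j → ind (not (does (p i ≟ p j)))) _) ⟩
  ∑∑ (λ i j → ind (not (does (p i ≟ p j))) + ind (does (p i ≟ p j)))
    ≡⟨ ∑∑-cong (λ i j → complement (does (p i ≟ p j))) ⟩
  ∑[ i < n ] ∑[ j < n ] 1     ≡⟨ sum-cong-≗ {n = n} (λ i → trans (sum-const {n} 1) (*-identityʳ n)) ⟩
  ∑[ i < n ] n                ≡⟨ sum-const {n} n ⟩
  n * n                       ∎
  where
  open ≡-Reasoning
  complement : ∀ b → ind (not b) + ind b ≡ 1
  complement true = refl
  complement false = refl

crossPairs-bound : ∀ {n} k (p : Fin n → Fin (suc k)) → suc k * crossPairs (λ _ → true) p ≤ k * (n * n)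
crossPairs-bound {n} k p = +-cancelʳ-≤ (n * n) _ _ (begin
  suc k * C + n * n           ≤⟨ +-monoʳ-≤ (suc k * C) n²≤[k+1]S ⟩
  suc k * C + suc k * S       ≡⟨ sym (*-distribˡ-+ (suc k) C S) ⟩
  suc k * (C + S)             ≡⟨ cong (suc k *_) (crossPairs+samePairs p) ⟩
  suc k * (n * n)             ≡⟨ +-comm (n * n) (k * (n * n)) ⟩
  k * (n * n) + n * n         ∎)
  where
  open ≤-Reasoning
  C S : ℕ
  C = crossPairs (λ _ → true) p
  S = ∑∑ (λ i j → ind (does (p i ≟ p j)))

  n²≤[k+1]S : n * n ≤ suc k * S
  n²≤[k+1]S = subst₂ (λ m Σs² → m * m ≤ suc k * Σs²) (sym (n≡∑partSize p)) (sym (samePairs≡∑partSize² p))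
                     (sum-square≤ (partSize p))

-- Deleting monochromatic edges, and averaging over two-colourings

monochromatic : ∀ {n} → Graph n → (Fin n → Bool) → Fin n → Fin n → Bool
monochromatic G c i j = adj G i j ∧ does (c i ≟ᵇ c j)

private
  same-sym : ∀ x y → does (x ≟ᵇ y) ≡ does (y ≟ᵇ x)
  same-sym true true = refl
  same-sym true false = refl
  same-sym false true = refl
  same-sym false false = refl

  ind-∧ : ∀ a b → ind (a ∧ b) ≡ when a (ind b)
  ind-∧ true b = refl
  ind-∧ false b = refl

tauB-monochromatic : ∀ {n} (G : Graph n) (c : Fin n → Bool) →
  TauBAtMost G (countEdges (monochromatic G c))
tauB-monochromatic G c =
  monochromatic G c , mono-sym , (λ i j → proj₁ ∘ to T-∧) , ≤-refl , c , properly-coloured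
  where
  mono-sym : ∀ i j → monochromatic G c i j ≡ monochromatic G c j i
  mono-sym i j = cong₂ _∧_ (adj-sym G i j) (same-sym (c i) (c j))
  properly-coloured : ∀ i j → T (minus (adj G) (monochromatic G c) i j) → c i ≢ c j
  properly-coloured i j t with adj G i j | c i ≟ᵇ c j
  ... | true  | no ci≢cj = ci≢cj
  ... | true  | yes _    = ⊥-elim t
  ... | false | _        = ⊥-elim t

countEdges-monochromatic : ∀ {n} (G : Graph n) (c : Fin n → Bool) →
  2 * countEdges (monochromatic G c) ≡ ∑∑ (λ i j → when (adj G i j) (ind (does (c i ≟ᵇ c j))))
countEdges-monochromatic G c =
  trans (countEdges-double (monochromatic G c) mono-sym mono-irr)
        (∑∑-cong λ i j → ind-∧ (adj G i j) _)
  where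
  mono-sym : ∀ i j → monochromatic G c i j ≡ monochromatic G c j i
  mono-sym i j = cong₂ _∧_ (adj-sym G i j) (same-sym (c i) (c j))
  mono-irr : ∀ i → monochromatic G c i i ≡ false
  mono-irr i = cong (_∧ _) (irrefl G i)

below-average : ∀ {K} (f : Fin (suc K) → ℕ) → Σ (Fin (suc K)) λ k → suc K * f k ≤ sum f
below-average {K} f = k , subst (_≤ sum f) (sum-const {suc K} (f k)) (sum-mono k-min)
  where
  k : Fin (suc K)
  k = argmin f zero (allFin (suc K))
  k-min : ∀ v → f k ≤ f v
  k-min v = All.lookup (f[argmin]≤f[xs] {f = f} zero (allFin (suc K))) (∈-allFin v)

Balanced : ∀ {K r} → (Fin (suc K) → Fin r → Bool) → ℕ → ℕ → Set
Balanced {K} col α β =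
  ∀ a b → ∑[ k < suc K ] ind (does (col k a ≟ᵇ col k b)) ≡ α + β * ind (does (a ≟ b))

best-colouring : ∀ {n r K} (G : Graph n) (p : Fin n → Fin r) (col : Fin (suc K) → Fin r → Bool)
  α β → Balanced col α β →
  Σ (Fin (suc K)) λ k → suc K * (2 * countEdges (monochromatic G (col k ∘ p)))
    ≤ α * ∑∑ (λ i j → ind (adj G i j)) + β * ∑∑ (λ i j → when (adj G i j) (ind (does (p i ≟ p j))))
best-colouring {n} {r} {K} G p col α β balanced =
  k , subst₂ _≤_ (cong (suc K *_) (sym (countEdges-monochromatic G (col k ∘ p)))) total k-good
  where
  f : Fin (suc K) → Fin n → Fin n → ℕ
  f k i j = when (adj G i j) (ind (does (col k (p i) ≟ᵇ col k (p j))))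
  E Ein : Fin n → Fin n → ℕ
  E i j = ind (adj G i j)
  Ein i j = when (adj G i j) (ind (does (p i ≟ p j)))

  mono : Fin (suc K) → ℕ
  mono k = ∑∑ (f k)
  k : Fin (suc K)
  k = proj₁ (below-average mono)
  k-good : suc K * mono k ≤ sum mono
  k-good = proj₂ (below-average mono)

  pointwise : ∀ i j → ∑[ k < suc K ] f k i j ≡ α * E i j + β * Ein i j
  pointwise i j with adj G i j
  ... | true  = trans (balanced (p i) (p j)) (cong (_+ _) (sym (*-identityʳ α)))
  ... | false = trans (sum-zero {suc K}) (sym (cong₂ _+_ (*-zeroʳ α) (*-zeroʳ β)))

  total : sum mono ≡ α * ∑∑ E + β * ∑∑ Ein
  total = begin
    ∑[ k < suc K ] ∑[ i < n ] ∑[ j < n ] f k i j   ≡⟨ ∑-comm (λ k i → ∑[ j < n ] f k i j) ⟩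
    ∑[ i < n ] ∑[ k < suc K ] ∑[ j < n ] f k i j   ≡⟨ sum-cong-≗ {n = n} (λ i → ∑-comm (λ k j → f k i j)) ⟩
    ∑∑ (λ i j → ∑[ k < suc K ] f k i j)           ≡⟨ ∑∑-cong pointwise ⟩
    ∑∑ (λ i j → α * E i j + β * Ein i j)           ≡⟨ ∑∑-+ (λ i j → α * E i j) (λ i j → β * Ein i j) ⟩
    ∑∑ (λ i j → α * E i j) + ∑∑ (λ i j → β * Ein i j) ≡⟨ cong₂ _+_ (∑∑-*ˡ α E) (∑∑-*ˡ β Ein) ⟩
    α * ∑∑ E + β * ∑∑ Ein                          ∎
    where open ≡-Reasoning

-- The general bound

edgeWeight-all : ∀ {n m} (G : Graph n) (p : Fin n → Fin m) →
  edgeWeight G (λ _ → true) p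
    ≡ ∑∑ (λ i j → ind (adj G i j)) + ∑∑ (λ i j → when (adj G i j) (ind (does (p i ≟ p j))))
edgeWeight-all G p = trans (∑∑-cong λ i j → split (adj G i j) _)
                           (∑∑-+ (λ i j → ind (adj G i j)) (λ i j → when (adj G i j) (ind (does (p i ≟ p j)))))
  where
  split : ∀ a y → when a (1 + y) ≡ ind a + when a y
  split true y = refl
  split false y = refl

private
  -- The linear arithmetic combining averaging, the partition lemma and
  -- Turán's bound (E, Ein: ordered edges, resp. inside parts; R: crossPairs).
  combine : ∀ k K α β t E Ein R N →
    suc K * (2 * t) ≤ α * E + β * Ein → E + Ein ≤ R → suc k * R ≤ k * N →
    suc k * (suc K * (2 * t) + β * E) ≤ suc k * (α * E) + β * (k * N)
  combine k K α β t E Ein R N averaging partition turán = begin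
    suc k * (suc K * (2 * t) + β * E)            ≤⟨ *-monoʳ-≤ (suc k) (+-monoˡ-≤ (β * E) averaging) ⟩
    suc k * (α * E + β * Ein + β * E)            ≡⟨ solve 5 (λ k α β E I →
                                                      (con 1 :+ k) :* (α :* E :+ β :* I :+ β :* E)
                                                   := (con 1 :+ k) :* (α :* E) :+ β :* ((con 1 :+ k) :* (E :+ I)))
                                                   refl k α β E Ein ⟩
    suc k * (α * E) + β * (suc k * (E + Ein))    ≤⟨ +-monoʳ-≤ _ (*-monoʳ-≤ β (*-monoʳ-≤ (suc k) partition)) ⟩
    suc k * (α * E) + β * (suc k * R)            ≤⟨ +-monoʳ-≤ _ (*-monoʳ-≤ β turán) ⟩
    suc k * (α * E) + β * (k * N)                ∎
    where open ≤-Reasoning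

tauB-bound : ∀ k {K} (col : Fin (suc K) → Fin (suc k) → Bool) α β → Balanced col α β →
  ∀ {n} (G : Graph n) → KFree G (2 + k) → ∀ t → (∀ s → TauBAtMost G s → t ≤ s) →
  suc k * (suc K * (2 * t) + β * (2 * edges G)) ≤ suc k * (α * (2 * edges G)) + β * (k * (n * n))
tauB-bound k {K} col α β balanced {n} G K-free t t-min =
  combine k K α β t (2 * edges G) Ein (crossPairs every p) (n * n) averaging partition (crossPairs-bound k p)
  where
  every : Fin n → Bool
  every _ = true
  good-partition : Σ (Fin n → Fin (suc k)) λ p → edgeWeight G every p ≤ crossPairs every p
  good-partition = partition-lemma k G every (λ f _ clique → K-free (f , clique))
  p : Fin n → Fin (suc k)
  p = proj₁ good-partition
  Ein : ℕ
  Ein = ∑∑ (λ i j → when (adj G i j) (ind (does (p i ≟ p j))))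

  handshake : 2 * edges G ≡ ∑∑ (λ i j → ind (adj G i j))
  handshake = countEdges-double (adj G) (adj-sym G) (irrefl G)

  partition : 2 * edges G + Ein ≤ crossPairs every p
  partition = subst (_≤ crossPairs every p) (trans (edgeWeight-all G p) (cong (_+ Ein) (sym handshake)))
                    (proj₂ good-partition)

  c : Fin n → Bool
  c = col (proj₁ (best-colouring G p col α β balanced)) ∘ p
  averaging : suc K * (2 * t) ≤ α * (2 * edges G) + β * Ein
  averaging = ≤-trans (*-monoʳ-≤ (suc K) (*-monoʳ-≤ 2 (t-min _ (tauB-monochromatic G c))))
                      (subst (λ E → suc K * (2 * countEdges (monochromatic G c)) ≤ α * E + β * Ein)
                             (sym handshake) (proj₂ (best-colouring G p col α β balanced)))

-- Balanced families of splittings and the corollary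

pairColouring : ∀ {r m} → Vec (Fin r × Fin r) m → Fin m → Fin r → Bool
pairColouring pairs k a = does (a ≟ proj₁ (lookup pairs k)) ∨ does (a ≟ proj₂ (lookup pairs k))

-- The three splittings of 4 parts into 2 + 2 (the side containing part 0).
splittings-2+2 : Fin 3 → Fin 4 → Bool
splittings-2+2 = pairColouring ((# 0 , # 1) ∷ (# 0 , # 2) ∷ (# 0 , # 3) ∷ [])

-- Two distinct parts share a side once, a part with itself three times.
balanced-2+2 : Balanced splittings-2+2 1 2
balanced-2+2 = toWitness {a? = all? λ a → all? λ b → _ ℕₚ.≟ _} tt

-- The ten splittings of 5 parts into 2 + 3 (the side of size 2).
splittings-2+3 : Fin 10 → Fin 5 → Bool
splittings-2+3 = pairColouring ((# 0 , # 1) ∷ (# 0 , # 2) ∷ (# 0 , # 3) ∷ (# 0 , # 4) ∷ (# 1 , # 2)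
                              ∷ (# 1 , # 3) ∷ (# 1 , # 4) ∷ (# 2 , # 3) ∷ (# 2 , # 4) ∷ (# 3 , # 4) ∷ [])

-- Two distinct parts share a side 1 + 3 times, a part with itself ten times.
balanced-2+3 : Balanced splittings-2+3 4 6
balanced-2+3 = toWitness {a? = all? λ a → all? λ b → _ ℕₚ.≟ _} tt

private
  -- tauB-bound for (k, K, α, β) = (3, 2, 1, 2) reads 24t + 16e ≤ 8e + 6n².
  rearrange-2+2 : ∀ t e N → 4 * (3 * (2 * t) + 2 * (2 * e)) ≤ 4 * (1 * (2 * e)) + 2 * (3 * N) →
    12 * t + 4 * e ≤ 3 * N
  rearrange-2+2 t e N bound = *-cancelˡ-≤ 2 (+-cancelʳ-≤ (8 * e) _ _ (subst₂ _≤_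
    (solve 2 (λ t e → con 4 :* (con 3 :* (con 2 :* t) :+ con 2 :* (con 2 :* e))
                   := con 2 :* (con 12 :* t :+ con 4 :* e) :+ con 8 :* e) refl t e)
    (solve 2 (λ e N → con 4 :* (con 1 :* (con 2 :* e)) :+ con 2 :* (con 3 :* N)
                   := con 2 :* (con 3 :* N) :+ con 8 :* e) refl e N)
    bound))

  -- tauB-bound for (k, K, α, β) = (4, 9, 4, 6) reads 100t + 60e ≤ 40e + 24n².
  rearrange-2+3 : ∀ t e N → 5 * (10 * (2 * t) + 6 * (2 * e)) ≤ 5 * (4 * (2 * e)) + 6 * (4 * N) →
    25 * t + 5 * e ≤ 6 * N
  rearrange-2+3 t e N bound = *-cancelˡ-≤ 4 (+-cancelʳ-≤ (40 * e) _ _ (subst₂ _≤_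
    (solve 2 (λ t e → con 5 :* (con 10 :* (con 2 :* t) :+ con 6 :* (con 2 :* e))
                   := con 4 :* (con 25 :* t :+ con 5 :* e) :+ con 40 :* e) refl t e)
    (solve 2 (λ e N → con 5 :* (con 4 :* (con 2 :* e)) :+ con 6 :* (con 4 :* N)
                   := con 4 :* (con 6 :* N) :+ con 40 :* e) refl e N)
    bound))

corollary4p5 :
    (∀ (n : ℕ) (G : Graph n) → KFree G 5 →
       ∀ (t : ℕ) → (∀ s → TauBAtMost G s → t ≤ s) → TauBAtMost G t →
       12 * t + 4 * edges G ≤ 3 * (n * n))
    × (∀ (n : ℕ) (G : Graph n) → KFree G 6 →
       ∀ (t : ℕ) → (∀ s → TauBAtMost G s → t ≤ s) → TauBAtMost G t →
       25 * t + 5 * edges G ≤ 6 * (n * n))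
corollary4p5 = part-a , part-b
  where
  part-a : ∀ n (G : Graph n) → KFree G 5 → ∀ t → (∀ s → TauBAtMost G s → t ≤ s) → TauBAtMost G t →
    12 * t + 4 * edges G ≤ 3 * (n * n)
  part-a n G K₅-free t t-min _ =
    rearrange-2+2 t (edges G) (n * n) (tauB-bound 3 splittings-2+2 1 2 balanced-2+2 G K₅-free t t-min)

  part-b : ∀ n (G : Graph n) → KFree G 6 → ∀ t → (∀ s → TauBAtMost G s → t ≤ s) → TauBAtMost G t →
    25 * t + 5 * edges G ≤ 6 * (n * n)
  part-b n G K₆-free t t-min _ =
    rearrange-2+3 t (edges G) (n * n) (tauB-bound 4 splittings-2+3 4 6 balanced-2+3 G K₆-free t t-min)
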